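{- Let $(G,r,k,c,\pi)$ be a $k$-PCST instance satisfying the standing assumptions below, with optimal value $\mathrm{OPT}$, and suppose there exists an optimal solution $F^\star=(V^\star,E^\star)$ of it with $\sum_{e\in E^\star}c(e)\le \mathrm{OPT}/2$. Then the output $F_{\rm OUT}=(V_{\rm OUT},E_{\rm OUT})$ of the algorithm $\mathcal{A}$ described below satisfies \[\sum_{e\in E_{\rm OUT}}c(e)+\sum_{v\notin V_{\rm OUT}}\pi(v)\le 3\,\mathrm{OPT}.\]
   Context: $k$-PCST: given an undirected connected graph $G=(V,E)$, a root $r\in V$, an integer $k\le|V|$, $c:E\to\mathbb{R}_+$ and $\pi:V\to\mathbb{R}_+$, find a subtree $F=(V_F,E_F)$ with $r\in V_F$, $|V_F|\ge k$, minimizing $\sum_{e\in E_F}c(e)+\sum_{v\notin V_F}\pi(v)$; minimum value $\mathrm{OPT}$. Rooted PCST $(G,r,c,\pi)$: same without the constraint $|V_F|\ge k$; optimal value $\mathrm{OPT}_{\rm PCST}$. Rooted $k$-MST $(G,r,k,c)$: subtree containing $r$ with at least $k$ vertices minimizing $\sum_{e\in E_F}c(e)$; optimal value $\mathrm{OPT}_{k\text{ -MST}}$. Standing assumptions: $G$ complete; $c$ satisfies the triangle inequality; $c(\{r,v\})<\mathrm{OPT}_{\rm PCST}$ for all $v\in V$; $\min_{e\in E}c(e)<\mathrm{OPT}$. Procedure 1 is the Goemans–Williamson primal–dual algorithm for rooted PCST, which returns a subtree $F=(V_F,E_F)$ containing $r$ with $\sum_{e\in E_F}c(e)+\sum_{v\notin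 V_F}\pi(v)\le 2\,\mathrm{OPT}_{\rm PCST}$. Procedure 2 is Garg's 2-approximation algorithm for rooted $k$-MST, which returns a subtree containing $r$ with exactly $k$ vertices and edge cost at most $2\,\mathrm{OPT}_{k\text{ -MST}}$. Algorithm $\mathcal{A}$: Step 1: apply Procedure 1 to $(G,r,c,\pi)$, obtaining $F_{\rm PCST}=(V_{\rm PCST},E_{\rm PCST})$; if $|V_{\rm PCST}|\ge k$, output $F_{\rm OUT}=F_{\rm PCST}$ and stop. Step 2: otherwise apply Procedure 2 to $(G,r,k,c)$, obtaining $F_{k\text{ -MST}}=(V_{k\text{ -MST}},E_{k\text{ -MST}})$. Step 3: form the graph $G'=(V_{\rm PCST}\cup V_{k\text{ -MST}},E_{\rm PCST}\cup E_{k\text{ -MST}})$, compute a minimum spanning tree $F_{\rm OUT}=(V_{\rm OUT},E_{\rm OUT})$ of $G'$ with respect to $c$, and output it.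
   Formalization: The edge costs c and the vertex penalties π take nonnegative rational values instead of values in $\mathbb{R}_+$. -}

module Defs where

open import Data.Nat as ℕ using (ℕ; zero; suc)
open import Data.Fin using (Fin; toℕ)
open import Data.Fin.Subset using (Subset; _∈_; _∉_; ∣_∣; _∪_)
open import Data.Fin.Subset.Properties using (_∈?_)
open import Data.Rational using (ℚ; 0ℚ; 1ℚ; _+_; _*_; _≤_; _<_)
open import Data.List using (List; []; _∷_; map; foldr; allFin; length; _++_)
open import Data.List.Relation.Unary.All using (All)
open import Data.List.Relation.Unary.Unique.Propositional using (Unique)
import Data.List.Membership.Propositional as LMem
open import Data.Product using (Σ; _×_; _,_; proj₁; proj₂)
open import Data.Sum using (_⊎_)
open import Relation.Binary.PropositionalEquality using (_≡_; _≢_)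
open import Relation.Nullary using (¬_; does)
open import Data.Bool using (if_then_else_)

-- Vertices of the complete graph are Fin n.  An edge {u,v} is stored
-- canonically as the ordered pair (u , v) with toℕ u < toℕ v.
Edge : ℕ → Set
Edge n = Fin n × Fin n

Cost : ℕ → Set
Cost n = Fin n → Fin n → ℚ

Penalty : ℕ → Set
Penalty n = Fin n → ℚ

2ℚ 3ℚ : ℚ
2ℚ = 1ℚ + 1ℚ
3ℚ = 2ℚ + 1ℚ

sumℚ : List ℚ → ℚ
sumℚ = foldr _+_ 0ℚ

record Subgraph (n : ℕ) : Set where
  constructor mkSubgraph
  field
    verts : Subset n
    edges : List (Edge n)
open Subgraph public

ValidCost : ∀ {n} → Cost n → Set
ValidCost {n} c =
  (∀ (u v : Fin n) → u ≢ v → 0ℚ ≤ c u v) ×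
  (∀ (u v : Fin n) → c u v ≡ c v u) ×
  (∀ (u v w : Fin n) → c u w ≤ c u v + c v w)

ValidPenalty : ∀ {n} → Penalty n → Set
ValidPenalty {n} π = ∀ (v : Fin n) → 0ℚ ≤ π v

data Path {n : ℕ} (E : List (Edge n)) : Fin n → Fin n → Set where
  here : ∀ {u} → Path E u u
  step : ∀ {u v w} → (LMem._∈_ (u , v) E ⊎ LMem._∈_ (v , u) E) → Path E v w → Path E u w

IsTree : ∀ {n} → Subgraph n → Set
IsTree {n} F =
  All (λ e → (toℕ (proj₁ e) ℕ.< toℕ (proj₂ e)) × (proj₁ e ∈ verts F) × (proj₂ e ∈ verts F)) (edges F) ×
  Unique (edges F) ×
  (∀ (u v : Fin n) → u ∈ verts F → v ∈ verts F → Path (edges F) u v) ×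
  (length (edges F) ℕ.+ 1 ≡ ∣ verts F ∣)

RootedTree : ∀ {n} → Fin n → Subgraph n → Set
RootedTree r F = (r ∈ verts F) × IsTree F

edgeCost : ∀ {n} → Cost n → Subgraph n → ℚ
edgeCost c F = sumℚ (map (λ e → c (proj₁ e) (proj₂ e)) (edges F))

penaltyCost : ∀ {n} → Penalty n → Subgraph n → ℚ
penaltyCost {n} π F = sumℚ (map (λ v → if does (v ∈? verts F) then 0ℚ else π v) (allFin n))

pcstCost : ∀ {n} → Cost n → Penalty n → Subgraph n → ℚ
pcstCost c π F = edgeCost c F + penaltyCost π F

KFeasible : ∀ {n} → Fin n → ℕ → Subgraph n → Set
KFeasible r k F = RootedTree r F × (k ℕ.≤ ∣ verts F ∣)

KPCSTOptimal : ∀ {n} → Fin n → ℕ → Cost n → Penalty n → Subgraph n → Set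
KPCSTOptimal r k c π F =
  KFeasible r k F × (∀ F' → KFeasible r k F' → pcstCost c π F ≤ pcstCost c π F')

-- Output guarantee of Procedure 1 (Goemans–Williamson): a rooted subtree with
-- objective ≤ 2 OPT_PCST, i.e. ≤ 2 × the objective of every rooted subtree.
PCST2Approx : ∀ {n} → Fin n → Cost n → Penalty n → Subgraph n → Set
PCST2Approx r c π F =
  RootedTree r F × (∀ F' → RootedTree r F' → pcstCost c π F ≤ 2ℚ * pcstCost c π F')

-- Output guarantee of Procedure 2 (Garg): a rooted subtree with exactly k vertices
-- and edge cost ≤ 2 OPT_{k-MST}.
KMST2Approx : ∀ {n} → Fin n → ℕ → Cost n → Subgraph n → Set
KMST2Approx r k c F =
  RootedTree r F × (∣ verts F ∣ ≡ k) ×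
  (∀ F' → KFeasible r k F' → edgeCost c F ≤ 2ℚ * edgeCost c F')

SpanningTreeOf : ∀ {n} → Subset n → List (Edge n) → Subgraph n → Set
SpanningTreeOf V' E' T =
  IsTree T × (verts T ≡ V') × All (λ e → LMem._∈_ e E') (edges T)

MSTOf : ∀ {n} → Cost n → Subset n → List (Edge n) → Subgraph n → Set
MSTOf c V' E' T =
  SpanningTreeOf V' E' T × (∀ T' → SpanningTreeOf V' E' T' → edgeCost c T ≤ edgeCost c T')

{-# OPTIONS --safe #-}
module Submission where

-- If F_PCST already has k vertices, its cost is at most 2·OPT_PCST ≤ 2·OPT ≤ 3·OPT
-- (OPT ≥ 0 because some edge costs less than OPT).  Otherwise F_PCST can be grown
-- into a spanning tree of G′ by repeatedly attaching a k-MST edge that leaves the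
-- current vertex set (one exists on the k-MST path from r to any vertex not yet
-- reached).  That tree competes with the MST, so c(E_OUT) ≤ c(E_PCST) + c(E_k-MST),
-- and V_OUT ⊇ V_PCST keeps the penalties below those of F_PCST.  Hence the output
-- costs at most cost(F_PCST) + c(E_k-MST) ≤ 2·OPT + 2·c(E⋆) ≤ 3·OPT, as F⋆ is
-- itself a competitor for both procedures.

open import Defs
open import Data.Nat as ℕ using (ℕ; zero; suc)
import Data.Nat.Properties as ℕ
open import Data.Fin as Fin using (Fin; toℕ)
open import Data.Fin.Properties using (any?)
open import Data.Fin.Subset using (Subset; _∈_; _∉_; ∣_∣; _∪_; _⊆_; ⁅_⁆; inside; outside)
open import Data.Fin.Subset.Properties
  using (_∈?_; ⊆⊤; ∈⊤; ∣⊤∣≡n; p⊂q⇒∣p∣<∣q∣; ⊆-antisym; x∈⁅x⁆; x∈⁅y⁆⇒x≡y;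
         x∈p∪q⁻; p⊆p∪q; q⊆p∪q; ∪-identityˡ)
open import Data.Rational using (ℚ; 0ℚ; 1ℚ; _+_; _*_; _≤_; _<_)
open import Data.Rational.Properties
  using (≤-refl; ≤-trans; <⇒≤; +-mono-≤; +-monoˡ-≤; +-monoʳ-≤; +-assoc; +-comm;
         +-identityˡ; +-identityʳ; *-identityˡ; *-distribʳ-+; module ≤-Reasoning)
open import Data.List using (List; []; _∷_; map; allFin; _++_)
open import Data.List.Relation.Unary.All as All using (All; []; _∷_)
import Data.List.Relation.Unary.All.Properties as All
open import Data.List.Relation.Unary.Any using (here; there)
open import Data.List.Relation.Unary.Unique.Propositional using (Unique; []; _∷_)
open import Data.List.Membership.Propositional using () renaming (_∈_ to _∈ₗ_)
open import Data.List.Membership.Propositional.Properties using (∈-∃++; ∈-++⁺ˡ; ∈-++⁺ʳ)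
open import Data.Product as Product using (∃; ∃₂; _×_; _,_; proj₁; proj₂)
open import Data.Sum as Sum using (_⊎_; inj₁; inj₂; [_,_])
open import Data.Vec using (_∷_; here; there)
open import Data.Bool using (if_then_else_)
open import Function using (_∘_; id)
open import Relation.Binary.PropositionalEquality
  using (_≡_; _≢_; refl; sym; trans; cong; subst; module ≡-Reasoning)
open import Relation.Nullary using (¬_; does; yes; no; contradiction)
open import Relation.Nullary.Decidable using (_×-dec_; ¬?)

private
  variable
    n : ℕ
    A : Set
    x y : A
    xs ys : List A

All-++∷⁻ : ∀ {P : A → Set} xs → All P (xs ++ y ∷ ys) → All P (xs ++ ys)
All-++∷⁻ []       (_ ∷ pys) = pys
All-++∷⁻ (_ ∷ xs) (px ∷ ps) = px ∷ All-++∷⁻ xs ps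

∈-++∷⁻ : ∀ xs → x ∈ₗ xs ++ y ∷ ys → x ≢ y → x ∈ₗ xs ++ ys
∈-++∷⁻ []       (here x≡y)  x≢y = contradiction x≡y x≢y
∈-++∷⁻ []       (there x∈)  _   = x∈
∈-++∷⁻ (_ ∷ xs) (here x≡z)  _   = here x≡z
∈-++∷⁻ (_ ∷ xs) (there x∈)  x≢y = there (∈-++∷⁻ xs x∈ x≢y)

Unique-++⁻ˡ : ∀ (xs : List A) → Unique (xs ++ ys) → Unique xs
Unique-++⁻ˡ []       _           = []
Unique-++⁻ˡ (_ ∷ xs) (x∉ ∷ uniq) = All.++⁻ˡ xs x∉ ∷ Unique-++⁻ˡ xs uniq

sumℚ-mono-≤ : ∀ {f g : A → ℚ} → (∀ x → f x ≤ g x) → ∀ xs → sumℚ (map f xs) ≤ sumℚ (map g xs)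
sumℚ-mono-≤ f≤g []       = ≤-refl
sumℚ-mono-≤ f≤g (x ∷ xs) = +-mono-≤ (f≤g x) (sumℚ-mono-≤ f≤g xs)

weight : Cost n → Edge n → ℚ
weight c e = c (proj₁ e) (proj₂ e)

edgeListCost : Cost n → List (Edge n) → ℚ
edgeListCost c E = sumℚ (map (weight c) E)

module _ (c : Cost n) where

  edgeListCost-++ : ∀ E E′ → edgeListCost c (E ++ E′) ≡ edgeListCost c E + edgeListCost c E′
  edgeListCost-++ []      E′ = sym (+-identityˡ _)
  edgeListCost-++ (e ∷ E) E′ =
    trans (cong (weight c e +_) (edgeListCost-++ E E′)) (sym (+-assoc (weight c e) _ _))

  edgeListCost-++∷ : ∀ E e E′ → edgeListCost c (E ++ e ∷ E′) ≡ weight c e + edgeListCost c (E ++ E′)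
  edgeListCost-++∷ []       e E′ = refl
  edgeListCost-++∷ (d ∷ E) e E′ = begin
    weight c d + edgeListCost c (E ++ e ∷ E′)              ≡⟨ cong (weight c d +_) (edgeListCost-++∷ E e E′) ⟩
    weight c d + (weight c e + edgeListCost c (E ++ E′))   ≡⟨ sym (+-assoc (weight c d) _ _) ⟩
    (weight c d + weight c e) + edgeListCost c (E ++ E′)   ≡⟨ cong (_+ edgeListCost c (E ++ E′)) (+-comm (weight c d) _) ⟩
    (weight c e + weight c d) + edgeListCost c (E ++ E′)   ≡⟨ +-assoc (weight c e) _ _ ⟩
    weight c e + edgeListCost c (d ∷ E ++ E′)              ∎
    where open ≡-Reasoning

  edgeListCost-nonneg : ∀ {E} → All (λ e → 0ℚ ≤ weight c e) E → 0ℚ ≤ edgeListCost c E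
  edgeListCost-nonneg []       = ≤-refl
  edgeListCost-nonneg (p ∷ ps) = +-mono-≤ p (edgeListCost-nonneg ps)

  edgeListCost-⊆ : ∀ {E E′} → All (λ e → 0ℚ ≤ weight c e) E′ →
                   Unique E → All (_∈ₗ E′) E → edgeListCost c E ≤ edgeListCost c E′
  edgeListCost-⊆ nonneg [] [] = edgeListCost-nonneg nonneg
  edgeListCost-⊆ {e ∷ E} nonneg (e∉E ∷ uniq) (e∈E′ ∷ E⊆E′) with ∈-∃++ e∈E′
  ... | F , F′ , refl = begin
    weight c e + edgeListCost c E         ≤⟨ +-monoʳ-≤ (weight c e) (edgeListCost-⊆ (All-++∷⁻ F nonneg) uniq E⊆F++F′) ⟩
    weight c e + edgeListCost c (F ++ F′) ≡⟨ sym (edgeListCost-++∷ F e F′) ⟩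
    edgeListCost c (F ++ e ∷ F′)          ∎
    where
    open ≤-Reasoning
    E⊆F++F′ = All.zipWith (λ (e≢d , d∈) → ∈-++∷⁻ F d∈ (e≢d ∘ sym)) (e∉E , E⊆E′)

penaltyCost-antitone : ∀ {π : Penalty n} → ValidPenalty π →
                       ∀ {F F′} → verts F ⊆ verts F′ → penaltyCost π F′ ≤ penaltyCost π F
penaltyCost-antitone {n} {π} π≥0 {F} {F′} V⊆V′ = sumℚ-mono-≤ pointwise (allFin n)
  where
  pointwise : ∀ v → (if does (v ∈? verts F′) then 0ℚ else π v) ≤ (if does (v ∈? verts F) then 0ℚ else π v)
  pointwise v with v ∈? verts F′ | v ∈? verts F
  ... | yes _    | yes _   = ≤-refl
  ... | yes _    | no _    = π≥0 v
  ... | no v∉V′ | yes v∈V = contradiction (V⊆V′ v∈V) v∉V′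
  ... | no _     | no _    = ≤-refl

∣⁅x⁆∪p∣≡1+∣p∣ : ∀ {x : Fin n} {p} → x ∉ p → ∣ ⁅ x ⁆ ∪ p ∣ ≡ suc ∣ p ∣
∣⁅x⁆∪p∣≡1+∣p∣ {x = Fin.zero}  {inside  ∷ p} x∉p = contradiction here x∉p
∣⁅x⁆∪p∣≡1+∣p∣ {x = Fin.zero}  {outside ∷ p} _   = cong (suc ∘ ∣_∣) (∪-identityˡ p)
∣⁅x⁆∪p∣≡1+∣p∣ {x = Fin.suc x} {inside  ∷ p} x∉p = cong suc (∣⁅x⁆∪p∣≡1+∣p∣ (x∉p ∘ there))
∣⁅x⁆∪p∣≡1+∣p∣ {x = Fin.suc x} {outside ∷ p} x∉p = ∣⁅x⁆∪p∣≡1+∣p∣ (x∉p ∘ there)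

x∉p⇒∣p∣<n : ∀ {x : Fin n} {p} → x ∉ p → ∣ p ∣ ℕ.< n
x∉p⇒∣p∣<n {n} {x} {p} x∉p = subst (∣ p ∣ ℕ.<_) (∣⊤∣≡n n) (p⊂q⇒∣p∣<∣q∣ (⊆⊤ , x , ∈⊤ , x∉p))

x∈⁅y⁆∪p⁻ : ∀ {x y : Fin n} {p} → x ∈ ⁅ y ⁆ ∪ p → x ≡ y ⊎ x ∈ p
x∈⁅y⁆∪p⁻ {y = y} {p} = Sum.map₁ (x∈⁅y⁆⇒x≡y y) ∘ x∈p∪q⁻ ⁅ y ⁆ p

Adjacent : List (Edge n) → Fin n → Fin n → Set
Adjacent E u v = (u , v) ∈ₗ E ⊎ (v , u) ∈ₗ E

WellFormed : Subset n → List (Edge n) → Set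
WellFormed V = All (λ e → (toℕ (proj₁ e) ℕ.< toℕ (proj₂ e)) × (proj₁ e ∈ V) × (proj₂ e ∈ V))

Connected : Subset n → List (Edge n) → Set
Connected V E = ∀ u v → u ∈ V → v ∈ V → Path E u v

module _ {E : List (Edge n)} where

  Path-mono : ∀ {E′ u v} → (∀ {e} → e ∈ₗ E → e ∈ₗ E′) → Path E u v → Path E′ u v
  Path-mono E⊆E′ here         = here
  Path-mono E⊆E′ (step u~ p) = step (Sum.map E⊆E′ E⊆E′ u~) (Path-mono E⊆E′ p)

  Path-trans : ∀ {u v w} → Path E u v → Path E v w → Path E u w
  Path-trans here         q = q
  Path-trans (step u~ p) q = step u~ (Path-trans p q)

  crossingEdge : ∀ (S : Subset n) {a b} → Path E a b → a ∈ S → b ∉ S →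
                 ∃₂ λ x y → x ∈ S × y ∉ S × Adjacent E x y
  crossingEdge S here                 a∈S b∉S = contradiction a∈S b∉S
  crossingEdge S (step {v = v} a~v p) a∈S b∉S with v ∈? S
  ... | yes v∈S = crossingEdge S p v∈S b∉S
  ... | no  v∉S = _ , v , a∈S , v∉S , a~v

Joins : Edge n → Fin n → Fin n → Set
Joins e x y = e ≡ (x , y) ⊎ e ≡ (y , x)

IsTree-addLeaf : ∀ {S : Subset n} {E x y} e → IsTree (mkSubgraph S E) → x ∈ S → y ∉ S →
                 Joins e x y → toℕ (proj₁ e) ℕ.< toℕ (proj₂ e) →
                 IsTree (mkSubgraph (⁅ y ⁆ ∪ S) (e ∷ E))
IsTree-addLeaf {S = S} {E} {x} {y} e (wf , uniq , conn , size) x∈S y∉S e-joins e-oriented =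
  (e-oriented , endpoints e-joins) ∷ All.map (Product.map₂ (Product.map S⊆S′ S⊆S′)) wf ,
  All.map (λ (_ , d∈S) e≡d → leaves (subst (λ d → Joins d x y) e≡d e-joins) d∈S) wf ∷ uniq ,
  conn′ ,
  trans (cong suc size) (sym (∣⁅x⁆∪p∣≡1+∣p∣ y∉S))
  where
  S⊆S′ : S ⊆ ⁅ y ⁆ ∪ S
  S⊆S′ = q⊆p∪q ⁅ y ⁆ S
  y∈S′ : y ∈ ⁅ y ⁆ ∪ S
  y∈S′ = p⊆p∪q S (x∈⁅x⁆ y)
  endpoints : ∀ {d} → Joins d x y → proj₁ d ∈ ⁅ y ⁆ ∪ S × proj₂ d ∈ ⁅ y ⁆ ∪ S
  endpoints (inj₁ refl) = S⊆S′ x∈S , y∈S′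
  endpoints (inj₂ refl) = y∈S′ , S⊆S′ x∈S
  leaves : ∀ {d} → Joins d x y → ¬ (proj₁ d ∈ S × proj₂ d ∈ S)
  leaves (inj₁ refl) (_ , y∈S) = y∉S y∈S
  leaves (inj₂ refl) (y∈S , _) = y∉S y∈S
  x~y : Adjacent (e ∷ E) x y
  x~y = Sum.map (here ∘ sym) (here ∘ sym) e-joins
  y~x : Adjacent (e ∷ E) y x
  y~x = Sum.swap x~y
  conn′ : Connected (⁅ y ⁆ ∪ S) (e ∷ E)
  conn′ u v u∈S′ v∈S′ with x∈⁅y⁆∪p⁻ u∈S′ | x∈⁅y⁆∪p⁻ v∈S′
  ... | inj₁ refl | inj₁ refl = here
  ... | inj₁ refl | inj₂ v∈S = step y~x (Path-mono there (conn x v x∈S v∈S))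
  ... | inj₂ u∈S | inj₁ refl = Path-trans (Path-mono there (conn u x u∈S x∈S)) (step x~y here)
  ... | inj₂ u∈S | inj₂ v∈S = Path-mono there (conn u v u∈S v∈S)

module _ {V₁ V₂ : Subset n} {E₁ E₂ : List (Edge n)} {r : Fin n}
         (r∈V₁ : r ∈ V₁) (wf₂ : WellFormed V₂ E₂) (conn₂ : Connected V₂ E₂) (r∈V₂ : r ∈ V₂) where

  attachVertex : ∀ {S E v} → IsTree (mkSubgraph S E) → r ∈ S → v ∈ V₂ → v ∉ S →
                 ∃₂ λ y e → y ∈ V₂ × y ∉ S × e ∈ₗ E₂ × IsTree (mkSubgraph (⁅ y ⁆ ∪ S) (e ∷ E))
  attachVertex {S} tree r∈S v∈V₂ v∉S with crossingEdge S (conn₂ r _ r∈V₂ v∈V₂) r∈S v∉S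
  ... | x , y , x∈S , y∉S , inj₁ xy∈E₂ =
    let (oriented , _ , y∈V₂) = All.lookup wf₂ xy∈E₂
    in  y , _ , y∈V₂ , y∉S , xy∈E₂ , IsTree-addLeaf _ tree x∈S y∉S (inj₁ refl) oriented
  ... | x , y , x∈S , y∉S , inj₂ yx∈E₂ =
    let (oriented , y∈V₂ , _) = All.lookup wf₂ yx∈E₂
    in  y , _ , y∈V₂ , y∉S , yx∈E₂ , IsTree-addLeaf _ tree x∈S y∉S (inj₂ refl) oriented

  SpanningExtension : Set
  SpanningExtension = ∃ λ A → All (_∈ₗ E₂) A × IsTree (mkSubgraph (V₁ ∪ V₂) (A ++ E₁))

  extend : ∀ fuel {S A} → n ℕ.≤ fuel ℕ.+ ∣ S ∣ → V₁ ⊆ S → S ⊆ V₁ ∪ V₂ →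
           All (_∈ₗ E₂) A → IsTree (mkSubgraph S (A ++ E₁)) → SpanningExtension
  extend fuel {S} {A} bound V₁⊆S S⊆V A⊆E₂ tree with any? (λ v → (v ∈? V₂) ×-dec ¬? (v ∈? S))
  ... | no V₂⊈S = A , A⊆E₂ , subst (λ T → IsTree (mkSubgraph T (A ++ E₁))) S≡V tree
    where
    V₂⊆S : V₂ ⊆ S
    V₂⊆S {v} v∈V₂ with v ∈? S
    ... | yes v∈S = v∈S
    ... | no  v∉S = contradiction (v , v∈V₂ , v∉S) V₂⊈S
    S≡V : S ≡ V₁ ∪ V₂
    S≡V = ⊆-antisym S⊆V ([ V₁⊆S , V₂⊆S ] ∘ x∈p∪q⁻ V₁ V₂)
  extend zero     bound _ _ _ _ | yes (_ , _ , v∉S) = contradiction bound (ℕ.<⇒≱ (x∉p⇒∣p∣<n v∉S))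
  extend (suc fuel) {S} bound V₁⊆S S⊆V A⊆E₂ tree | yes (_ , v∈V₂ , v∉S)
    with attachVertex tree (V₁⊆S r∈V₁) v∈V₂ v∉S
  ... | y , e , y∈V₂ , y∉S , e∈E₂ , tree′ =
    extend fuel bound′ (q⊆p∪q ⁅ y ⁆ S ∘ V₁⊆S) S′⊆V (e∈E₂ ∷ A⊆E₂) tree′
    where
    bound′ : n ℕ.≤ fuel ℕ.+ ∣ ⁅ y ⁆ ∪ S ∣
    bound′ = subst (n ℕ.≤_) (trans (sym (ℕ.+-suc fuel ∣ S ∣)) (cong (fuel ℕ.+_) (sym (∣⁅x⁆∪p∣≡1+∣p∣ y∉S)))) bound
    S′⊆V : ⁅ y ⁆ ∪ S ⊆ V₁ ∪ V₂
    S′⊆V = [ (λ { refl → q⊆p∪q V₁ V₂ y∈V₂ }) , S⊆V ] ∘ x∈⁅y⁆∪p⁻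

  spanningExtension : IsTree (mkSubgraph V₁ E₁) → SpanningExtension
  spanningExtension = extend n (ℕ.m≤m+n n ∣ V₁ ∣) id (p⊆p∪q V₂) []

MSTOf-edgeCost-≤ : ∀ {c : Cost n} {r F₁ F₂ T} → (∀ u v → u ≢ v → 0ℚ ≤ c u v) →
                   RootedTree r F₁ → RootedTree r F₂ →
                   MSTOf c (verts F₁ ∪ verts F₂) (edges F₁ ++ edges F₂) T →
                   edgeCost c T ≤ edgeCost c F₁ + edgeCost c F₂
MSTOf-edgeCost-≤ {c = c} {F₁ = F₁} {F₂} {T} c≥0 (r∈V₁ , tree₁) (r∈V₂ , wf₂ , _ , conn₂ , _) (_ , minimal)
  with spanningExtension r∈V₁ wf₂ conn₂ r∈V₂ tree₁
... | A , A⊆E₂ , tree = begin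
  edgeCost c T                          ≤⟨ minimal (mkSubgraph _ (A ++ edges F₁)) (tree , refl , spans) ⟩
  edgeListCost c (A ++ edges F₁)        ≡⟨ edgeListCost-++ c A (edges F₁) ⟩
  edgeListCost c A + edgeCost c F₁      ≤⟨ +-monoˡ-≤ (edgeCost c F₁) (edgeListCost-⊆ c E₂≥0 (Unique-++⁻ˡ A (proj₁ (proj₂ tree))) A⊆E₂) ⟩
  edgeCost c F₂ + edgeCost c F₁         ≡⟨ +-comm (edgeCost c F₂) _ ⟩
  edgeCost c F₁ + edgeCost c F₂         ∎
  where
  open ≤-Reasoning
  spans : All (_∈ₗ edges F₁ ++ edges F₂) (A ++ edges F₁)
  spans = All.++⁺ (All.map (∈-++⁺ʳ (edges F₁)) A⊆E₂) (All.tabulate ∈-++⁺ˡ)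
  E₂≥0 : All (λ e → 0ℚ ≤ weight c e) (edges F₂)
  E₂≥0 = All.map (λ (u<v , _) → c≥0 _ _ (λ u≡v → ℕ.<-irrefl (cong toℕ u≡v) u<v)) wf₂

MSTOf-pcstCost-≤ : ∀ {c : Cost n} {π : Penalty n} {r F₁ F₂ T} →
                   (∀ u v → u ≢ v → 0ℚ ≤ c u v) → ValidPenalty π →
                   RootedTree r F₁ → RootedTree r F₂ →
                   MSTOf c (verts F₁ ∪ verts F₂) (edges F₁ ++ edges F₂) T →
                   pcstCost c π T ≤ edgeCost c F₂ + pcstCost c π F₁
MSTOf-pcstCost-≤ {c = c} {π} {F₁ = F₁} {F₂} {T} c≥0 π≥0 rooted₁ rooted₂ mst@((_ , V≡ , _) , _) = begin
  edgeCost c T + penaltyCost π T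
    ≤⟨ +-mono-≤ (MSTOf-edgeCost-≤ c≥0 rooted₁ rooted₂ mst) (penaltyCost-antitone π≥0 {F₁} {T} V₁⊆V) ⟩
  (edgeCost c F₁ + edgeCost c F₂) + penaltyCost π F₁
    ≡⟨ cong (_+ penaltyCost π F₁) (+-comm (edgeCost c F₁) _) ⟩
  (edgeCost c F₂ + edgeCost c F₁) + penaltyCost π F₁
    ≡⟨ +-assoc (edgeCost c F₂) _ _ ⟩
  edgeCost c F₂ + pcstCost c π F₁ ∎
  where
  open ≤-Reasoning
  V₁⊆V : verts F₁ ⊆ verts T
  V₁⊆V = subst (verts F₁ ⊆_) (sym V≡) (p⊆p∪q (verts F₂))

3x≡2x+x : ∀ x → 3ℚ * x ≡ 2ℚ * x + x
3x≡2x+x x = trans (*-distribʳ-+ x 2ℚ 1ℚ) (cong (2ℚ * x +_) (*-identityˡ x))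

2x≤3x : ∀ {x} → 0ℚ ≤ x → 2ℚ * x ≤ 3ℚ * x
2x≤3x {x} 0≤x = begin
  2ℚ * x      ≡⟨ sym (+-identityʳ _) ⟩
  2ℚ * x + 0ℚ ≤⟨ +-monoʳ-≤ (2ℚ * x) 0≤x ⟩
  2ℚ * x + x  ≡⟨ sym (3x≡2x+x x) ⟩
  3ℚ * x      ∎
  where open ≤-Reasoning

proposition1 : ∀ (n : ℕ) (r : Fin n) (k : ℕ) (c : Cost n) (π : Penalty n) →
    k ℕ.≤ n → ValidCost c → ValidPenalty π →
    -- c({r,v}) < OPT_PCST for every v
    (∀ (v : Fin n) → v ≢ r → ∀ F → RootedTree r F → c r v < pcstCost c π F) →
    -- an optimal k-PCST solution F⋆ with c(E⋆) ≤ OPT/2, and min_e c(e) < OPT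
    ∀ (Fstar : Subgraph n) → KPCSTOptimal r k c π Fstar →
    (∃ λ (u : Fin n) → ∃ λ (v : Fin n) → (u ≢ v) × (c u v < pcstCost c π Fstar)) →
    2ℚ * edgeCost c Fstar ≤ pcstCost c π Fstar →
    -- Step 1: any output F_PCST of Procedure 1
    ∀ (Fpcst : Subgraph n) → PCST2Approx r c π Fpcst →
    -- if |V_PCST| ≥ k the output is F_PCST
    ((k ℕ.≤ ∣ verts Fpcst ∣ → pcstCost c π Fpcst ≤ 3ℚ * pcstCost c π Fstar) ×
    -- otherwise: Steps 2 and 3
     (∣ verts Fpcst ∣ ℕ.< k →
       ∀ (Fkmst : Subgraph n) → KMST2Approx r k c Fkmst →
       ∀ (Fout : Subgraph n) →
         MSTOf c (verts Fpcst ∪ verts Fkmst) (edges Fpcst ++ edges Fkmst) Fout →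
         pcstCost c π Fout ≤ 3ℚ * pcstCost c π Fstar))
proposition1 n r k c π _ (c≥0 , _) π≥0 _ F⋆ (F⋆-feasible , _) (u , v , u≢v , cuv<OPT) 2c⋆≤OPT
             Fpcst (Fpcst-rooted , Fpcst-2approx) = pcstOutput , mstOutput
  where
  OPT = pcstCost c π F⋆
  Fpcst≤2OPT : pcstCost c π Fpcst ≤ 2ℚ * OPT
  Fpcst≤2OPT = Fpcst-2approx F⋆ (proj₁ F⋆-feasible)
  pcstOutput : k ℕ.≤ ∣ verts Fpcst ∣ → pcstCost c π Fpcst ≤ 3ℚ * OPT
  pcstOutput _ = ≤-trans Fpcst≤2OPT (2x≤3x (≤-trans (c≥0 u v u≢v) (<⇒≤ cuv<OPT)))
  mstOutput : ∣ verts Fpcst ∣ ℕ.< k → ∀ Fkmst → KMST2Approx r k c Fkmst →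
              ∀ Fout → MSTOf c (verts Fpcst ∪ verts Fkmst) (edges Fpcst ++ edges Fkmst) Fout →
              pcstCost c π Fout ≤ 3ℚ * OPT
  mstOutput _ Fkmst (Fkmst-rooted , _ , Fkmst-2approx) Fout mst = begin
    pcstCost c π Fout                     ≤⟨ MSTOf-pcstCost-≤ c≥0 π≥0 Fpcst-rooted Fkmst-rooted mst ⟩
    edgeCost c Fkmst + pcstCost c π Fpcst ≤⟨ +-mono-≤ (≤-trans (Fkmst-2approx F⋆ F⋆-feasible) 2c⋆≤OPT) Fpcst≤2OPT ⟩
    OPT + 2ℚ * OPT                        ≡⟨ trans (+-comm OPT _) (sym (3x≡2x+x OPT)) ⟩
    3ℚ * OPT                              ∎
    where open ≤-Reasoning
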